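{- Let $p$ be an odd prime and $r$ a positive integer. Then \[ \sum_{k=0}^{\frac{p^r-1}2}\frac{4k+3}{16(k+1)^4\,256^k}{\binom{2k}k}^4 \equiv 1-5p^{4r}\pmod{p^{4r+1}}, \] and \[ \sum_{k=0}^{p^r-2}\frac{4k+3}{16(k+1)^4\,256^k}{\binom{2k}k}^4 \equiv 1-5p^{4r}\pmod{p^{4r+1}}. \]
   Context: Congruences between rational numbers modulo $p^{m}$ are understood in the ring of rationals whose denominators are coprime to $p$ (i.e. $A\equiv B\pmod{p^m}$ means $A-B$ equals $p^m$ times a $p$-integral rational number). -}

module Defs where

open import Data.Nat as ℕ using (ℕ; zero; suc; NonZero)
open import Data.Nat.Divisibility using (_∣_)
open import Data.Nat.Properties using (m*n≢0; m^n≢0)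
open import Data.Nat.Combinatorics using (_C_)
open import Data.Integer using (ℤ; +_)
open import Data.Rational as ℚ using (ℚ; _/_; _+_; _-_; _*_; 0ℚ)
open import Data.Product using (∃; _×_)
open import Relation.Nullary using (¬_)
open import Relation.Binary.PropositionalEquality using (_≡_)

den : ℕ → ℕ
den k = 16 ℕ.* ((suc k) ℕ.^ 4) ℕ.* (256 ℕ.^ k)

den≢0 : ∀ k → NonZero (den k)
den≢0 k = m*n≢0 (16 ℕ.* (suc k ℕ.^ 4)) (256 ℕ.^ k)
  {{m*n≢0 16 (suc k ℕ.^ 4) {{_}} {{m^n≢0 (suc k) 4}}}} {{m^n≢0 256 k}}

term : ℕ → ℚ
term k = _/_ (+ ((4 ℕ.* k ℕ.+ 3) ℕ.* ((2 ℕ.* k) C k) ℕ.^ 4)) (den k) {{den≢0 k}}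

-- Σ_{k=0}^{n} term k   (inclusive upper limit n)
sumTo : ℕ → ℚ
sumTo zero = term 0
sumTo (suc n) = sumTo n + term (suc n)

PIntegral : ℕ → ℚ → Set
PIntegral p q = ¬ (_∣_ p (ℚ.denominatorℕ q))

-- A ≡ B (mod p^m) in the ring of p-integral rationals
Cong : ℕ → ℕ → ℚ → ℚ → Set
Cong p m A B = ∃ λ x → PIntegral p x × (A - B ≡ (+ (p ℕ.^ m) / 1) * x)

-- With F(m) = (8m²+4m+1) C(2m,m)⁴ / 256^m one has term K = F(K) - F(K+1), a
-- polynomial identity once C(2K+2,K+1) = 2(2K+1)/(K+1) · C(2K,K) is used; as F(0) = 1 the
-- partial sums are  sumTo n = 1 - F(n+1).  Each congruence is therefore F(m) ≡ 5q⁴ mod p^{4r+1}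
-- for m = (q+1)/2 resp. m = q-1, i.e.  5q⁴·256^m ≡ (8m²+4m+1) C(2m,m)⁴.
--
-- In both cases C(2m,m)·W = q·V for explicit W prime to p and V; multiplying by W⁴
-- turns the wanted congruence into q⁴·(5·256^m·W⁴ - (8m²+4m+1)·V⁴) ≡ 0, so it suffices to
-- check 5·256^m·W⁴ ≡ (8m²+4m+1)·V⁴ modulo p only, and then cancel W⁴ modulo p^{4r+1}.
--
-- Modulo p.  Since p divides C(q,j) for 0 < j < q, we get 2^q ≡ 2, C(q+a,b) ≡ C(a,b) for b < q
-- and C(q-1,j) ≡ (-1)^j; these evaluate W, V, 256^m and 8m²+4m+1 modulo p in both cases.
module Submission where

module Fractions where

  open import Data.Nat as ℕ using (suc; NonZero)
  import Data.Nat.Properties as ℕP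
  open import Data.Nat.Divisibility using (_∣_; divides)
  open import Data.Integer as ℤ using (ℤ; +_)
  import Data.Integer.Properties as ℤP
  import Data.Integer.GCD as ℤGCD
  open import Data.Integer.Tactic.RingSolver using (solve-∀)
  open import Data.Rational as ℚ using (ℚ; _/_; toℚᵘ)
  import Data.Rational.Properties as ℚP
  import Data.Rational.Unnormalised as ℚᵘ
  import Data.Rational.Unnormalised.Properties as ℚᵘP
  open import Relation.Binary.PropositionalEquality

  toℚᵘ-/ : ∀ i n .{{_ : NonZero n}} → toℚᵘ (i / n) ℚᵘ.≃ (i ℚᵘ./ n)
  toℚᵘ-/ i (suc n) = ℚP.toℚᵘ-fromℚᵘ (ℚᵘ.mkℚᵘ i n)

  ≡-via-ℚᵘ : ∀ {x y} u → toℚᵘ x ℚᵘ.≃ u → toℚᵘ y ℚᵘ.≃ u → x ≡ y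
  ≡-via-ℚᵘ u x≃u y≃u = ℚP.toℚᵘ-injective (ℚᵘP.≃-trans x≃u (ℚᵘP.≃-sym y≃u))

  /-sum : ∀ a b c d e f .{{_ : NonZero d}} .{{_ : NonZero e}} .{{_ : NonZero f}} →
          (a ℕ.* e ℕ.+ b ℕ.* d) ℕ.* f ≡ c ℕ.* (d ℕ.* e) →
          (+ a / d) ℚ.+ (+ b / e) ≡ + c / f
  /-sum a b c d@(suc _) e@(suc _) f@(suc _) eq = ≡-via-ℚᵘ (+ c ℚᵘ./ f)
    (ℚᵘP.≃-trans (ℚP.toℚᵘ-homo-+ (+ a / d) (+ b / e))
      (ℚᵘP.≃-trans (ℚᵘP.+-cong (toℚᵘ-/ (+ a) d) (toℚᵘ-/ (+ b) e)) (ℚᵘ.*≡* cast)))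
    (toℚᵘ-/ (+ c) f)
    where
    cast : (+ a ℤ.* + e ℤ.+ + b ℤ.* + d) ℤ.* + f ≡ + c ℤ.* + (d ℕ.* e)
    cast = begin
      (+ a ℤ.* + e ℤ.+ + b ℤ.* + d) ℤ.* + f  ≡⟨ cong (ℤ._* + f) (cong₂ ℤ._+_ (ℤP.pos-* a e) (ℤP.pos-* b d)) ⟨
      (+ (a ℕ.* e) ℤ.+ + (b ℕ.* d)) ℤ.* + f  ≡⟨ cong (ℤ._* + f) (ℤP.pos-+ (a ℕ.* e) (b ℕ.* d)) ⟨
      + (a ℕ.* e ℕ.+ b ℕ.* d) ℤ.* + f        ≡⟨ ℤP.pos-* (a ℕ.* e ℕ.+ b ℕ.* d) f ⟨
      + ((a ℕ.* e ℕ.+ b ℕ.* d) ℕ.* f)        ≡⟨ cong +_ eq ⟩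
      + (c ℕ.* (d ℕ.* e))                    ≡⟨ ℤP.pos-* c (d ℕ.* e) ⟩
      + c ℤ.* + (d ℕ.* e)                    ∎
      where open ≡-Reasoning

  integer-minus-/ : ∀ a b c z e .{{_ : NonZero e}} → a ℤ.* + e ℤ.- b ≡ c ℤ.* z →
                    (a / 1) ℚ.- (b / e) ≡ (c / 1) ℚ.* (z / e)
  integer-minus-/ a b c z e@(suc _) eq = ≡-via-ℚᵘ (c ℚᵘ./ 1 ℚᵘ.* (z ℚᵘ./ e))
    (ℚᵘP.≃-trans (ℚP.toℚᵘ-homo-+ (a / 1) (ℚ.- (b / e)))
      (ℚᵘP.≃-trans (ℚᵘP.+-cong (toℚᵘ-/ a 1) (ℚᵘP.≃-trans (ℚP.toℚᵘ-homo‿- (b / e)) (ℚᵘP.-‿cong (toℚᵘ-/ b e))))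
        (ℚᵘ.*≡* (cong (ℤ._* + (1 ℕ.* e)) (trans (shape a b (+ e)) eq)))))
    (ℚᵘP.≃-trans (ℚP.toℚᵘ-homo-* (c / 1) (z / e)) (ℚᵘP.*-cong (toℚᵘ-/ c 1) (toℚᵘ-/ z e)))
    where
    shape : ∀ a b (e : ℤ) → a ℤ.* e ℤ.+ ℤ.- b ℤ.* + 1 ≡ a ℤ.* e ℤ.- b
    shape = solve-∀

  denominator-/∣ : ∀ i n .{{_ : NonZero n}} → ℚ.denominatorℕ (i / n) ∣ n
  denominator-/∣ i n = divides ℤ.∣ g ∣ (begin
      n                                   ≡⟨ cong ℤ.∣_∣ (ℚP.↧-/ i n) ⟨
      ℤ.∣ ℚ.↧ (i / n) ℤ.* g ∣               ≡⟨ ℤP.abs-* (ℚ.↧ (i / n)) g ⟩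
      ℚ.denominatorℕ (i / n) ℕ.* ℤ.∣ g ∣   ≡⟨ ℕP.*-comm (ℚ.denominatorℕ (i / n)) ℤ.∣ g ∣ ⟩
      ℤ.∣ g ∣ ℕ.* ℚ.denominatorℕ (i / n)   ∎)
    where
    open ≡-Reasoning
    g : ℤ
    g = ℤGCD.gcd i (+ n)

module Binomials where

  open import Data.Nat using (ℕ; zero; suc; _+_; _*_; _^_; _∸_; _≤_; s≤s; z≤n)
  open import Data.Nat.Properties using (+-comm; *-zeroʳ; *-identityʳ; +-identityʳ; m≤m+n; n≤1+n; ≤-trans; m+n∸m≡n; n<1+n)
  open import Data.Nat.Combinatorics using (_C_; nCk+nC[k+1]≡[n+1]C[k+1]; k>n⇒nCk≡0; nCk≡nC[n∸k]; nC1≡n)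
  open import Data.Nat.Tactic.RingSolver using (solve-∀)
  open import Relation.Binary.PropositionalEquality

  pascal : ∀ n k → suc n C suc k ≡ n C k + n C suc k
  pascal n k = sym (nCk+nC[k+1]≡[n+1]C[k+1] n k)

  absorption : ∀ n k → suc k * (suc n C suc k) ≡ suc n * (n C k)
  absorption zero zero = refl
  absorption zero (suc k) = begin
    suc (suc k) * (1 C suc (suc k)) ≡⟨ cong (suc (suc k) *_) (k>n⇒nCk≡0 {1} {suc (suc k)} (s≤s (s≤s z≤n))) ⟩
    suc (suc k) * 0                 ≡⟨ *-zeroʳ (suc (suc k)) ⟩
    0                               ≡⟨ cong (_+ 0) (k>n⇒nCk≡0 {0} {suc k} (s≤s z≤n)) ⟨
    1 * (0 C suc k)                 ∎
    where open ≡-Reasoning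
  absorption (suc n) zero = begin
    1 * (suc (suc n) C 1) ≡⟨ +-identityʳ _ ⟩
    suc (suc n) C 1       ≡⟨ nC1≡n (suc (suc n)) ⟩
    suc (suc n)           ≡⟨ *-identityʳ (suc (suc n)) ⟨
    suc (suc n) * 1       ∎
    where open ≡-Reasoning
  absorption (suc n) (suc k) = begin
    suc (suc k) * (suc (suc n) C suc (suc k))
      ≡⟨ cong (suc (suc k) *_) (pascal (suc n) (suc k)) ⟩
    suc (suc k) * (a + b)
      ≡⟨ split a b k ⟩
    suc k * a + a + suc (suc k) * b
      ≡⟨ cong₂ (λ x y → x + a + y) (absorption n k) (absorption n (suc k)) ⟩
    suc n * (n C k) + a + suc n * (n C suc k)
      ≡⟨ merge (n C k) (n C suc k) a n ⟩
    suc n * (n C k + n C suc k) + a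
      ≡⟨ cong (λ x → suc n * x + a) (pascal n k) ⟨
    suc n * a + a
      ≡⟨ +-comm (suc n * a) a ⟩
    suc (suc n) * a ∎
    where
    open ≡-Reasoning
    a b : ℕ
    a = suc n C suc k
    b = suc n C suc (suc k)
    split : ∀ a b k → suc (suc k) * (a + b) ≡ suc k * a + a + suc (suc k) * b
    split = solve-∀
    merge : ∀ x y a n → suc n * x + a + suc n * y ≡ suc n * (x + y) + a
    merge = solve-∀

  middle-absorption : ∀ m → suc m * (suc (2 * m) C m) ≡ suc (2 * m) * (2 * m C m)
  middle-absorption m = begin
    suc m * (suc (2 * m) C m)                 ≡⟨ cong (suc m *_) (nCk≡nC[n∸k] (m≤2m+1 m)) ⟩
    suc m * (suc (2 * m) C (suc (2 * m) ∸ m)) ≡⟨ cong (λ k → suc m * (suc (2 * m) C k)) (complement m) ⟩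
    suc m * (suc (2 * m) C suc m)             ≡⟨ absorption (2 * m) m ⟩
    suc (2 * m) * (2 * m C m)                 ∎
    where
    open ≡-Reasoning
    m≤2m+1 : ∀ m → m ≤ suc (2 * m)
    m≤2m+1 m = ≤-trans (m≤m+n m (m + 0)) (n≤1+n (2 * m))
    complement : ∀ m → suc (2 * m) ∸ m ≡ suc m
    complement m = trans (cong (_∸ m) (split m)) (m+n∸m≡n m (suc m))
      where
      split : ∀ m → suc (2 * m) ≡ m + suc m
      split = solve-∀

  central-step : ∀ K → suc K * (2 * suc K C suc K) ≡ 2 * (2 * K + 1) * (2 * K C K)
  central-step K = begin
    suc K * (2 * suc K C suc K)              ≡⟨ cong (λ n → suc K * (n C suc K)) (two-suc K) ⟩
    suc K * (suc (suc (2 * K)) C suc K)      ≡⟨ absorption (suc (2 * K)) K ⟩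
    suc (suc (2 * K)) * (suc (2 * K) C K)    ≡⟨ double K (suc (2 * K) C K) ⟩
    2 * (suc K * (suc (2 * K) C K))          ≡⟨ cong (2 *_) (middle-absorption K) ⟩
    2 * (suc (2 * K) * (2 * K C K))          ≡⟨ regroup K (2 * K C K) ⟩
    2 * (2 * K + 1) * (2 * K C K)            ∎
    where
    open ≡-Reasoning
    two-suc : ∀ K → 2 * suc K ≡ suc (suc (2 * K))
    two-suc = solve-∀
    double : ∀ K b → (2 + 2 * K) * b ≡ 2 * ((1 + K) * b)
    double = solve-∀
    regroup : ∀ K c → 2 * ((1 + 2 * K) * c) ≡ 2 * (2 * K + 1) * c
    regroup = solve-∀

  rowPrefix : ℕ → ℕ → ℕ
  rowPrefix n zero = 0
  rowPrefix n (suc k) = rowPrefix n k + n C k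

  rowPrefix-pascal : ∀ n k → rowPrefix (suc n) (suc k) ≡ rowPrefix n k + rowPrefix n (suc k)
  rowPrefix-pascal n zero = refl
  rowPrefix-pascal n (suc k) = begin
    rowPrefix (suc n) (suc k) + suc n C suc k
      ≡⟨ cong₂ _+_ (rowPrefix-pascal n k) (pascal n k) ⟩
    (rowPrefix n k + rowPrefix n (suc k)) + (n C k + n C suc k)
      ≡⟨ regroup (rowPrefix n k) (n C k) (n C suc k) ⟩
    (rowPrefix n k + n C k) + (rowPrefix n (suc k) + n C suc k)
      ∎
    where
    open ≡-Reasoning
    regroup : ∀ s a b → (s + (s + a)) + (a + b) ≡ (s + a) + ((s + a) + b)
    regroup = solve-∀

  row-sum : ∀ n → rowPrefix n (suc n) ≡ 2 ^ n
  row-sum zero = refl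
  row-sum (suc n) = begin
    rowPrefix (suc n) (suc (suc n))          ≡⟨ rowPrefix-pascal n (suc n) ⟩
    rowPrefix n (suc n) + (rowPrefix n (suc n) + n C suc n)
      ≡⟨ cong (λ c → rowPrefix n (suc n) + (rowPrefix n (suc n) + c)) (k>n⇒nCk≡0 (n<1+n n)) ⟩
    rowPrefix n (suc n) + (rowPrefix n (suc n) + 0)
      ≡⟨ cong (λ s → s + (s + 0)) (row-sum n) ⟩
    2 ^ n + (2 ^ n + 0)                      ∎
    where open ≡-Reasoning

module Congruences where

  open import Data.Nat as ℕ using (ℕ; zero; suc)
  import Data.Nat.Divisibility as ℕ∣
  open import Data.Integer using (ℤ; +_; _+_; _*_; _-_; -_; _^_; 0ℤ; -1ℤ)
  import Data.Integer.Properties as ℤP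
  open import Data.Integer.Divisibility.Signed using (_∣_; divides; *-monoʳ-∣; ∣m∣n⇒∣m+n; ∣m⇒∣-m; ∣n⇒∣m*n; ∣m⇒∣m*n; ∣ᵤ⇒∣; ∣⇒∣ᵤ)
  open import Data.Integer.Tactic.RingSolver using (solve-∀)
  open import Relation.Binary.Bundles using (Setoid)
  import Relation.Binary.Reasoning.Setoid as SetoidReasoning
  open import Relation.Nullary using (¬_)
  open import Relation.Binary.PropositionalEquality

  pos-^ : ∀ a n → + (a ℕ.^ n) ≡ (+ a) ^ n
  pos-^ a zero    = refl
  pos-^ a (suc n) = trans (ℤP.pos-* a (a ℕ.^ n)) (cong (+ a *_) (pos-^ a n))

  infix 4 _≡_mod_
  record _≡_mod_ (a b : ℤ) (m : ℕ) : Set where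
    constructor mk≡
    field divides-difference : + m ∣ a - b
  open _≡_mod_ public

  module _ {m : ℕ} where

    private
      diff-sym : ∀ a b → b - a ≡ - (a - b)
      diff-sym = solve-∀
      diff-trans : ∀ a b c → a - c ≡ (a - b) + (b - c)
      diff-trans = solve-∀
      diff-+ : ∀ a b c d → (a + c) - (b + d) ≡ (a - b) + (c - d)
      diff-+ = solve-∀
      diff-* : ∀ a b c d → (a * c) - (b * d) ≡ (a - b) * c + b * (c - d)
      diff-* = solve-∀
      diff-neg : ∀ a b → (- a) - (- b) ≡ - (a - b)
      diff-neg = solve-∀

    mod-refl : ∀ {a} → a ≡ a mod m
    mod-refl {a} = mk≡ (divides 0ℤ (trans (ℤP.+-inverseʳ a) (sym (ℤP.*-zeroˡ (+ m)))))

    mod-sym : ∀ {a b} → a ≡ b mod m → b ≡ a mod m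
    mod-sym {a} {b} (mk≡ d) = mk≡ (subst (+ m ∣_) (sym (diff-sym a b)) (∣m⇒∣-m d))

    mod-trans : ∀ {a b c} → a ≡ b mod m → b ≡ c mod m → a ≡ c mod m
    mod-trans {a} {b} {c} (mk≡ d) (mk≡ e) = mk≡ (subst (+ m ∣_) (sym (diff-trans a b c)) (∣m∣n⇒∣m+n d e))

    +-cong : ∀ {a b c d} → a ≡ b mod m → c ≡ d mod m → a + c ≡ b + d mod m
    +-cong {a} {b} {c} {d} (mk≡ e) (mk≡ f) = mk≡ (subst (+ m ∣_) (sym (diff-+ a b c d)) (∣m∣n⇒∣m+n e f))

    *-cong : ∀ {a b c d} → a ≡ b mod m → c ≡ d mod m → a * c ≡ b * d mod m
    *-cong {a} {b} {c} {d} (mk≡ e) (mk≡ f) =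
      mk≡ (subst (+ m ∣_) (sym (diff-* a b c d)) (∣m∣n⇒∣m+n (∣m⇒∣m*n c e) (∣n⇒∣m*n b f)))

    neg-cong : ∀ {a b} → a ≡ b mod m → - a ≡ - b mod m
    neg-cong {a} {b} (mk≡ e) = mk≡ (subst (+ m ∣_) (sym (diff-neg a b)) (∣m⇒∣-m e))

    -‿cong : ∀ {a b c d} → a ≡ b mod m → c ≡ d mod m → a - c ≡ b - d mod m
    -‿cong e f = +-cong e (neg-cong f)

    ^-cong : ∀ {a b} n → a ≡ b mod m → a ^ n ≡ b ^ n mod m
    ^-cong zero    e = mod-refl
    ^-cong (suc n) e = *-cong e (^-cong n e)

  mod-setoid : ℕ → Setoid _ _
  mod-setoid m = record
    { _≈_ = λ a b → a ≡ b mod m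
    ; isEquivalence = record { refl = mod-refl ; sym = mod-sym ; trans = mod-trans } }

  module ≡-mod-Reasoning (m : ℕ) = SetoidReasoning (mod-setoid m)

  module _ {m : ℕ} where
    open ≡-mod-Reasoning m

    *-cong⁺ : ∀ {a b x y} → + a ≡ x mod m → + b ≡ y mod m → + (a ℕ.* b) ≡ x * y mod m
    *-cong⁺ {a} {b} e f = subst (_≡ _ mod m) (sym (ℤP.pos-* a b)) (*-cong e f)

    ^-cong⁺ : ∀ {a x} n → + a ≡ x mod m → + (a ℕ.^ n) ≡ x ^ n mod m
    ^-cong⁺ {a} n e = subst (_≡ _ mod m) (sym (pos-^ a n)) (^-cong n e)

    ∣⇒≡0 : ∀ {x} → m ℕ∣.∣ x → + x ≡ 0ℤ mod m
    ∣⇒≡0 {x} d = mk≡ (subst (+ m ∣_) (sym (ℤP.+-identityʳ (+ x))) (∣ᵤ⇒∣ d))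

    remove-multiple : ∀ {q} → m ℕ∣.∣ q → ∀ {x} y k → x ≡ q ℕ.* y ℕ.+ k → + x ≡ + k mod m
    remove-multiple {q} m∣q y k refl = subst (_≡ + k mod m) (sym (ℤP.pos-+ (q ℕ.* y) k))
      (+-cong (∣⇒≡0 (ℕ∣.∣m⇒∣m*n y m∣q)) (mod-refl {a = + k}))

    complete-multiple : ∀ {q} → m ℕ∣.∣ q → ∀ {x} y k → x ℕ.+ k ≡ q ℕ.* y → + x ≡ - + k mod m
    complete-multiple {q} m∣q {x} y k eq = begin
      + x                  ≡⟨ shape (+ x) (+ k) ⟨
      (+ x + + k) - + k    ≡⟨ cong (_- + k) (ℤP.pos-+ x k) ⟨
      + (x ℕ.+ k) - + k    ≡⟨ cong (λ z → + z - + k) eq ⟩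
      + (q ℕ.* y) - + k    ≈⟨ -‿cong (∣⇒≡0 (ℕ∣.∣m⇒∣m*n y m∣q)) (mod-refl {a = + k}) ⟩
      0ℤ - + k             ≡⟨ ℤP.+-identityˡ (- + k) ⟩
      - + k                ∎
      where
      shape : ∀ a b → (a + b) - b ≡ a
      shape = solve-∀

    ≡-1⇒∤ : ¬ m ℕ∣.∣ 1 → ∀ {x} → + x ≡ -1ℤ mod m → ¬ m ℕ∣.∣ x
    ≡-1⇒∤ m∤1 x≡-1 m∣x = m∤1 (∣⇒∣ᵤ (divides-difference (mod-trans (mod-sym (∣⇒≡0 m∣x)) x≡-1)))

    scale : ∀ k {x y} → + x ≡ + y mod m → + (k ℕ.* x) ≡ + (k ℕ.* y) mod (k ℕ.* m)
    scale k {x} {y} (mk≡ d) = mk≡ (subst₂ _∣_ (sym (ℤP.pos-* k m)) (sym casts) (*-monoʳ-∣ (+ k) d))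
      where
      factor : ∀ k x y → k * x - k * y ≡ k * (x - y)
      factor = solve-∀
      casts : + (k ℕ.* x) - + (k ℕ.* y) ≡ + k * (+ x - + y)
      casts = trans (cong₂ _-_ (ℤP.pos-* k x) (ℤP.pos-* k y)) (factor (+ k) (+ x) (+ y))

module PrimePowers where

  open import Data.Nat as ℕ using (ℕ; zero; suc; _+_; _*_; _^_; _<_; s≤s; z≤n)
  import Data.Nat.Properties as ℕP
  open import Data.Nat.Divisibility using (_∣_; _∣?_; divides; ∣1⇒≡1; ∣⇒≤; ∣-trans; m∣m*n; *-cancelˡ-∣; *-monoʳ-∣)
  open import Data.Nat.Primality using (Prime; euclidsLemma; prime⇒nonTrivial)
  open import Data.Nat.Combinatorics using (_C_; nCn≡1)
  open import Data.Integer as ℤ using (ℤ; +_; 0ℤ; 1ℤ; -1ℤ)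
  import Data.Integer.Properties as ℤP
  open import Data.Integer.Divisibility.Signed using (∣ᵤ⇒∣; ∣⇒∣ᵤ)
  import Data.Integer.Tactic.RingSolver as ℤRing
  import Data.Nat.Tactic.RingSolver as ℕRing
  open import Data.Sum using (inj₁; inj₂)
  open import Relation.Nullary using (¬_; yes; no; contradiction)
  open import Relation.Binary.PropositionalEquality
  open Binomials
  open Congruences

  module PrimeDivisibility {p : ℕ} (prime : Prime p) where

    instance
      p-nonTrivial : ℕ.NonTrivial p
      p-nonTrivial = prime⇒nonTrivial prime

    p>1 : 1 < p
    p>1 = ℕ.nonTrivial⇒n>1 p

    p∤1 : ¬ p ∣ 1
    p∤1 p∣1 = ℕ.nonTrivial⇒≢1 (∣1⇒≡1 p∣1)

    ∤-^ : ∀ {w} → ¬ p ∣ w → ∀ n → ¬ p ∣ w ^ n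
    ∤-^ p∤w zero = p∤1
    ∤-^ {w} p∤w (suc n) p∣w^n+1 with euclidsLemma w (w ^ n) prime p∣w^n+1
    ... | inj₁ p∣w   = p∤w p∣w
    ... | inj₂ p∣w^n = ∤-^ p∤w n p∣w^n

    prime-power-cancel : ∀ k {a w} → ¬ p ∣ w → p ^ k ∣ a * w → p ^ k ∣ a
    prime-power-cancel zero {a} _ _ = divides a (sym (ℕP.*-identityʳ a))
    prime-power-cancel (suc k) {a} {w} p∤w p^k+1∣aw
      with euclidsLemma a w prime (∣-trans (m∣m*n (p ^ k)) p^k+1∣aw)
    ... | inj₂ p∣w = contradiction p∣w p∤w
    ... | inj₁ (divides a′ refl) =
      subst (p * p ^ k ∣_) (ℕP.*-comm p a′) (*-monoʳ-∣ p p^k∣a′)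
      where
      p^k∣a′ : p ^ k ∣ a′
      p^k∣a′ = prime-power-cancel k p∤w
        (*-cancelˡ-∣ p {{ℕ.nonTrivial⇒nonZero p}} (subst (p * p ^ k ∣_) (regroup a′ p w) p^k+1∣aw))
        where
        regroup : ∀ a p w → a * p * w ≡ p * (a * w)
        regroup = ℕRing.solve-∀

    cancel-mod : ∀ {k a b w} → ¬ p ∣ w → + (a * w) ≡ + (b * w) mod (p ^ k) → + a ≡ + b mod (p ^ k)
    cancel-mod {k} {a} {b} {w} p∤w (mk≡ d) = mk≡ (∣ᵤ⇒∣ (prime-power-cancel k p∤w (subst (p ^ k ∣_) factor (∣⇒∣ᵤ d))))
      where
      distrib : ∀ a b w → a ℤ.* w ℤ.- b ℤ.* w ≡ (a ℤ.- b) ℤ.* w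
      distrib = ℤRing.solve-∀
      factor : ℤ.∣ + (a * w) ℤ.- + (b * w) ∣ ≡ ℤ.∣ + a ℤ.- + b ∣ * w
      factor = begin
        ℤ.∣ + (a * w) ℤ.- + (b * w) ∣       ≡⟨ cong ℤ.∣_∣ (cong₂ ℤ._-_ (ℤP.pos-* a w) (ℤP.pos-* b w)) ⟩
        ℤ.∣ + a ℤ.* + w ℤ.- + b ℤ.* + w ∣   ≡⟨ cong ℤ.∣_∣ (distrib (+ a) (+ b) (+ w)) ⟩
        ℤ.∣ (+ a ℤ.- + b) ℤ.* + w ∣         ≡⟨ ℤP.abs-* (+ a ℤ.- + b) (+ w) ⟩
        ℤ.∣ + a ℤ.- + b ∣ * w               ∎
        where open ≡-Reasoning

    cancel-mod-prime : ∀ {a b w} → ¬ p ∣ w → + (a * w) ≡ + (b * w) mod p → + a ≡ + b mod p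
    cancel-mod-prime {a} {b} {w} p∤w aw≡bw = subst (+ a ≡ + b mod_) (ℕP.^-identityʳ p)
      (cancel-mod {k = 1} p∤w (subst (+ (a * w) ≡ + (b * w) mod_) (sym (ℕP.^-identityʳ p)) aw≡bw))

    -- p divides every inner binomial coefficient C(p^r, j), 0 < j < p^r: from
    -- j C(q,j) = q C(q-1,j-1), a p-free C(q,j) would force q = p^r ∣ j.
    divides-binomial : ∀ r {q} → q ≡ p ^ r → ∀ {j} → 0 < j → j < q → p ∣ q C j
    divides-binomial r {suc q} q≡p^r {suc j} _ j<q with p ∣? (suc q C suc j)
    ... | yes p∣C = p∣C
    ... | no  p∤C = contradiction (∣⇒≤ q∣j) (ℕP.<⇒≱ j<q)
      where
      q∣j : suc q ∣ suc j
      q∣j = subst (_∣ suc j) (sym q≡p^r) (prime-power-cancel r p∤C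
        (subst (_∣ suc j * (suc q C suc j)) q≡p^r (subst (suc q ∣_) (sym (absorption q j)) (m∣m*n (q C j)))))

  module InnerBinomialsVanish {p q : ℕ} (p∣C : ∀ {j} → 0 < j → j < q → p ∣ q C j) where

    open ≡-mod-Reasoning p

    rowPrefix≡1 : ∀ k → k < q → + rowPrefix q (suc k) ≡ 1ℤ mod p
    rowPrefix≡1 zero    _   = mod-refl
    rowPrefix≡1 (suc k) k<q = begin
      + (rowPrefix q (suc k) + q C suc k)    ≡⟨ ℤP.pos-+ (rowPrefix q (suc k)) (q C suc k) ⟩
      + rowPrefix q (suc k) ℤ.+ + (q C suc k) ≈⟨ +-cong (rowPrefix≡1 k (ℕP.<-trans (ℕP.n<1+n k) k<q)) (∣⇒≡0 (p∣C (s≤s z≤n) k<q)) ⟩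
      1ℤ ℤ.+ 0ℤ                                ∎

    two^q≡2 : 0 < q → + (2 ^ q) ≡ + 2 mod p
    two^q≡2 (s≤s {n = k} z≤n) = begin
      + (2 ^ q)                          ≡⟨ cong +_ (row-sum q) ⟨
      + (rowPrefix q (suc k) + q C q)    ≡⟨ ℤP.pos-+ (rowPrefix q (suc k)) (q C q) ⟩
      + rowPrefix q (suc k) ℤ.+ + (q C q) ≈⟨ +-cong (rowPrefix≡1 k ℕP.≤-refl) (mod-refl {a = + (q C q)}) ⟩
      1ℤ ℤ.+ + (q C q)                   ≡⟨ cong (λ c → 1ℤ ℤ.+ + c) (nCn≡1 q) ⟩
      + 2                                ∎

    shift : ∀ a b → b < q → + ((q + a) C b) ≡ + (a C b) mod p
    shift zero zero    _   = mod-refl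
    shift zero (suc b) b<q = subst (λ n → + (n C suc b) ≡ 0ℤ mod p) (sym (ℕP.+-identityʳ q)) (∣⇒≡0 (p∣C (s≤s z≤n) b<q))
    shift (suc a) zero    _   = mod-refl
    shift (suc a) (suc b) b<q = begin
      + ((q + suc a) C suc b)                   ≡⟨ cong (λ n → + (n C suc b)) (ℕP.+-suc q a) ⟩
      + (suc (q + a) C suc b)                   ≡⟨ cong +_ (pascal (q + a) b) ⟩
      + ((q + a) C b + (q + a) C suc b)         ≡⟨ ℤP.pos-+ ((q + a) C b) ((q + a) C suc b) ⟩
      + ((q + a) C b) ℤ.+ + ((q + a) C suc b)   ≈⟨ +-cong (shift a b (ℕP.<-trans (ℕP.n<1+n b) b<q)) (shift a (suc b) b<q) ⟩
      + (a C b) ℤ.+ + (a C suc b)               ≡⟨ ℤP.pos-+ (a C b) (a C suc b) ⟨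
      + (a C b + a C suc b)                     ≡⟨ cong +_ (pascal a b) ⟨
      + (suc a C suc b)                         ∎

    alternating : ∀ {Q} → q ≡ suc Q → ∀ j → j < q → + (Q C j) ≡ -1ℤ ℤ.^ j mod p
    alternating q≡Q+1 zero    _   = mod-refl
    alternating {Q} q≡Q+1 (suc j) j<q = begin
      + (Q C suc j)                              ≡⟨ cancel (+ (Q C j)) (+ (Q C suc j)) ⟨
      (+ (Q C j) ℤ.+ + (Q C suc j)) ℤ.- + (Q C j) ≡⟨ cong (ℤ._- + (Q C j)) (ℤP.pos-+ (Q C j) (Q C suc j)) ⟨
      + (Q C j + Q C suc j) ℤ.- + (Q C j)        ≡⟨ cong (λ c → + c ℤ.- + (Q C j)) (pascal Q j) ⟨
      + (suc Q C suc j) ℤ.- + (Q C j)            ≈⟨ -‿cong (∣⇒≡0 (subst (λ n → p ∣ n C suc j) q≡Q+1 (p∣C (s≤s z≤n) j<q)))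
                                                            (alternating q≡Q+1 j (ℕP.<-trans (ℕP.n<1+n j) j<q)) ⟩
      0ℤ ℤ.- -1ℤ ℤ.^ j                           ≡⟨ negate (-1ℤ ℤ.^ j) ⟩
      -1ℤ ℤ.* -1ℤ ℤ.^ j                          ∎
      where
      cancel : ∀ a b → (a ℤ.+ b) ℤ.- a ≡ b
      cancel = ℤRing.solve-∀
      negate : ∀ x → 0ℤ ℤ.- x ≡ -1ℤ ℤ.* x
      negate = ℤRing.solve-∀

module Telescoping where

  open import Data.Nat using (ℕ; zero; suc; _+_; _*_; _^_)
  import Data.Nat.Properties as ℕP
  open import Data.Nat.Combinatorics using (_C_)
  open import Data.Nat.Solver using (module +-*-Solver)
  open import Data.Integer using (+_)
  open import Data.Rational as ℚ using (ℚ; _/_; 1ℚ)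
  import Data.Rational.Properties as ℚP
  open import Relation.Binary.PropositionalEquality
  open import Defs
  open Fractions
  open Binomials

  weight : ℕ → ℕ
  weight m = 8 * m * m + 4 * m + 1

  tail : ℕ → ℚ
  tail m = (+ (weight m * (2 * m C m) ^ 4) / 256 ^ m) {{ℕP.m^n≢0 256 m}}

  -- Cleared of denominators, term K + F(K+1) = F(K) is a polynomial identity in K and C(2K,K),
  -- once C(2K+2,K+1) is eliminated with central-step.
  tail-step-numerators : ∀ K →
    ((4 * K + 3) * (2 * K C K) ^ 4 * 256 ^ suc K + weight (suc K) * (2 * suc K C suc K) ^ 4 * den K) * 256 ^ K
    ≡ weight K * (2 * K C K) ^ 4 * (den K * 256 ^ suc K)
  tail-step-numerators K = begin
    ((4 * K + 3) * c ^ 4 * (256 * A) + weight (suc K) * c′ ^ 4 * (16 * suc K ^ 4 * A)) * A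
      ≡⟨ gather K c c′ A ⟩
    ((4 * K + 3) * c ^ 4 * (256 * A) + 16 * weight (suc K) * (suc K * c′) ^ 4 * A) * A
      ≡⟨ cong (λ x → ((4 * K + 3) * c ^ 4 * (256 * A) + 16 * weight (suc K) * x ^ 4 * A) * A) (central-step K) ⟩
    ((4 * K + 3) * c ^ 4 * (256 * A) + 16 * weight (suc K) * (2 * (2 * K + 1) * c) ^ 4 * A) * A
      ≡⟨ polynomial K c A ⟩
    weight K * c ^ 4 * (16 * suc K ^ 4 * A * (256 * A)) ∎
    where
    open ≡-Reasoning
    open +-*-Solver
    c c′ A : ℕ
    c = 2 * K C K
    c′ = 2 * suc K C suc K
    A = 256 ^ K
    gather : ∀ K c c′ A →
      ((4 * K + 3) * c ^ 4 * (256 * A) + weight (1 + K) * c′ ^ 4 * (16 * (1 + K) ^ 4 * A)) * A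
      ≡ ((4 * K + 3) * c ^ 4 * (256 * A) + 16 * weight (1 + K) * ((1 + K) * c′) ^ 4 * A) * A
    gather = solve 4 (λ K c c′ A →
      ((con 4 :* K :+ con 3) :* c :^ 4 :* (con 256 :* A) :+ W (con 1 :+ K) :* c′ :^ 4 :* (con 16 :* (con 1 :+ K) :^ 4 :* A)) :* A
      := ((con 4 :* K :+ con 3) :* c :^ 4 :* (con 256 :* A) :+ con 16 :* W (con 1 :+ K) :* ((con 1 :+ K) :* c′) :^ 4 :* A) :* A) refl
      where W = λ m → con 8 :* m :* m :+ con 4 :* m :+ con 1
    polynomial : ∀ K c A →
      ((4 * K + 3) * c ^ 4 * (256 * A) + 16 * weight (1 + K) * (2 * (2 * K + 1) * c) ^ 4 * A) * A
      ≡ weight K * c ^ 4 * (16 * (1 + K) ^ 4 * A * (256 * A))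
    polynomial = solve 3 (λ K c A →
      ((con 4 :* K :+ con 3) :* c :^ 4 :* (con 256 :* A) :+ con 16 :* W (con 1 :+ K) :* (con 2 :* (con 2 :* K :+ con 1) :* c) :^ 4 :* A) :* A
      := W K :* c :^ 4 :* (con 16 :* (con 1 :+ K) :^ 4 :* A :* (con 256 :* A))) refl
      where W = λ m → con 8 :* m :* m :+ con 4 :* m :+ con 1

  tail-step : ∀ K → term K ℚ.+ tail (suc K) ≡ tail K
  tail-step K = /-sum ((4 * K + 3) * (2 * K C K) ^ 4) (weight (suc K) * (2 * suc K C suc K) ^ 4)
    (weight K * (2 * K C K) ^ 4) (den K) (256 ^ suc K) (256 ^ K)
    {{den≢0 K}} {{ℕP.m^n≢0 256 (suc K)}} {{ℕP.m^n≢0 256 K}} (tail-step-numerators K)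

  sumTo+tail : ∀ n → sumTo n ℚ.+ tail (suc n) ≡ 1ℚ
  sumTo+tail zero    = tail-step 0
  sumTo+tail (suc n) = begin
    sumTo n ℚ.+ term (suc n) ℚ.+ tail (suc (suc n))   ≡⟨ ℚP.+-assoc (sumTo n) (term (suc n)) (tail (suc (suc n))) ⟩
    sumTo n ℚ.+ (term (suc n) ℚ.+ tail (suc (suc n))) ≡⟨ cong (sumTo n ℚ.+_) (tail-step (suc n)) ⟩
    sumTo n ℚ.+ tail (suc n)                          ≡⟨ sumTo+tail n ⟩
    1ℚ                                                ∎
    where open ≡-Reasoning

module Lifting where

  open import Data.Nat as ℕ using (ℕ; suc; _+_; _*_; _^_)
  import Data.Nat.Properties as ℕP
  open import Data.Nat.Divisibility using (_∣_; ∣-trans)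
  open import Data.Nat.Primality using (Prime)
  open import Data.Nat.Combinatorics using (_C_)
  open import Data.Nat.Solver using (module +-*-Solver)
  open import Data.Integer as ℤ using (ℤ; +_)
  open import Data.Integer.Divisibility.Signed using (divides)
  import Data.Integer.Properties as ℤP
  open import Data.Rational as ℚ using (ℚ; _/_; 1ℚ)
  open import Data.Rational.Solver renaming (module +-*-Solver to ℚ-Solver)
  open import Data.Product using (_,_)
  open import Relation.Nullary using (¬_)
  open import Relation.Binary.PropositionalEquality
  open import Defs
  open Fractions
  open Congruences
  open PrimePowers
  open Telescoping

  module Reduction {p : ℕ} (prime : Prime p) (r : ℕ) where

    open PrimeDivisibility prime

    p^[k+1] : ∀ k → p ^ (k + 1) ≡ p ^ k * p
    p^[k+1] k = trans (ℕP.^-distribˡ-+-* p k 1) (cong (p ^ k *_) (ℕP.*-identityʳ p))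

    p^[4r] : p ^ (4 * r) ≡ (p ^ r) ^ 4
    p^[4r] = trans (cong (p ^_) (ℕP.*-comm 4 r)) (sym (ℕP.^-*-assoc p r 4))

    clear-fourth-powers : ∀ {P c w Q v} → c * w ≡ Q * v → P * c ^ 4 * w ^ 4 ≡ Q ^ 4 * (P * v ^ 4)
    clear-fourth-powers {P} {c} {w} {Q} {v} cw≡Qv = begin
      P * c ^ 4 * w ^ 4      ≡⟨ solve 3 (λ P c w → P :* c :^ 4 :* w :^ 4 := P :* (c :* w) :^ 4) refl P c w ⟩
      P * (c * w) ^ 4        ≡⟨ cong (λ x → P * x ^ 4) cw≡Qv ⟩
      P * (Q * v) ^ 4        ≡⟨ solve 3 (λ P Q v → P :* (Q :* v) :^ 4 := Q :^ 4 :* (P :* v :^ 4)) refl P Q v ⟩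
      Q ^ 4 * (P * v ^ 4)    ∎
      where
      open ≡-Reasoning
      open +-*-Solver

    -- Key lifting step: if c·w = p^r·v with p ∤ w and 5·A·w⁴ ≡ P·v⁴ (mod p),
    -- then 5·p^{4r}·A ≡ P·c⁴ (mod p^{4r+1}): multiply by w⁴, factor out (p^r)⁴, cancel w⁴.
    lift : ∀ {A P c w v} → c * w ≡ p ^ r * v → ¬ p ∣ w →
           + (5 * A * w ^ 4) ≡ + (P * v ^ 4) mod p →
           + (5 * p ^ (4 * r) * A) ≡ + (P * c ^ 4) mod (p ^ (4 * r + 1))
    lift {A} {P} {c} {w} {v} cw≡qv p∤w 5Aw⁴≡Pv⁴ = cancel-mod {k = 4 * r + 1} (∤-^ p∤w 4)
      (subst (λ N → + (5 * p ^ (4 * r) * A * w ^ 4) ≡ + (P * c ^ 4 * w ^ 4) mod N) (sym (p^[k+1] (4 * r))) (begin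
        + (5 * p ^ (4 * r) * A * w ^ 4)    ≡⟨ cong +_ (pull-out (p ^ (4 * r)) A (w ^ 4)) ⟩
        + (p ^ (4 * r) * (5 * A * w ^ 4))  ≈⟨ scale (p ^ (4 * r)) 5Aw⁴≡Pv⁴ ⟩
        + (p ^ (4 * r) * (P * v ^ 4))      ≡⟨ cong (λ Q → + (Q * (P * v ^ 4))) p^[4r] ⟩
        + ((p ^ r) ^ 4 * (P * v ^ 4))      ≡⟨ cong +_ (clear-fourth-powers {P} {c} {w} {p ^ r} {v} cw≡qv) ⟨
        + (P * c ^ 4 * w ^ 4)              ∎))
      where
      open ≡-mod-Reasoning (p ^ (4 * r) * p)
      pull-out : ∀ X A Y → 5 * X * A * Y ≡ X * (5 * A * Y)
      pull-out = solve 3 (λ X A Y → con 5 :* X :* A :* Y := X :* (con 5 :* A :* Y)) refl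
        where open +-*-Solver

    -- Translating back through the telescoped sum: a congruence 5·p^{4r}·256^m ≡ numerator of F(m)
    -- modulo p^{4r+1} is exactly the claimed congruence for the partial sum up to n = m - 1.
    sum-congruence : ¬ p ∣ 2 → ∀ n → let m = suc n in
      + (5 * p ^ (4 * r) * 256 ^ m) ≡ + (weight m * (2 * m C m) ^ 4) mod (p ^ (4 * r + 1)) →
      Cong p (4 * r + 1) (sumTo n) (1ℚ ℚ.- (+ (5 * p ^ (4 * r)) / 1))
    sum-congruence p∤2 n (mk≡ (divides z X-Y≡zN)) = x , p-integral , difference
      where
      m : ℕ
      m = suc n
      instance
        256^m≢0 : ℕ.NonZero (256 ^ m)
        256^m≢0 = ℕP.m^n≢0 256 m
      x : ℚ
      x = z / 256 ^ m
      p-integral : PIntegral p x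
      p-integral p∣den = ∤-^ (∤-^ p∤2 8) m (∣-trans p∣den (denominator-/∣ z (256 ^ m)))
      G : ℚ
      G = + (5 * p ^ (4 * r)) / 1
      difference : sumTo n ℚ.- (1ℚ ℚ.- G) ≡ (+ (p ^ (4 * r + 1)) / 1) ℚ.* x
      difference = begin
        sumTo n ℚ.- (1ℚ ℚ.- G)                   ≡⟨ cong (λ one → sumTo n ℚ.- (one ℚ.- G)) (sumTo+tail n) ⟨
        sumTo n ℚ.- ((sumTo n ℚ.+ tail m) ℚ.- G) ≡⟨ rearrange (sumTo n) (tail m) G ⟩
        G ℚ.- tail m                             ≡⟨ integer-minus-/ (+ (5 * p ^ (4 * r))) (+ (weight m * (2 * m C m) ^ 4))
                                                      (+ (p ^ (4 * r + 1))) z (256 ^ m) numerators ⟩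
        (+ (p ^ (4 * r + 1)) / 1) ℚ.* x          ∎
        where
        open ≡-Reasoning
        rearrange : ∀ S F G → S ℚ.- ((S ℚ.+ F) ℚ.- G) ≡ G ℚ.- F
        rearrange = solve 3 (λ S F G → S :- ((S :+ F) :- G) := G :- F) refl
          where open ℚ-Solver
        numerators : + (5 * p ^ (4 * r)) ℤ.* + (256 ^ m) ℤ.- + (weight m * (2 * m C m) ^ 4) ≡ + (p ^ (4 * r + 1)) ℤ.* z
        numerators = trans (cong (ℤ._- _) (sym (ℤP.pos-* (5 * p ^ (4 * r)) (256 ^ m))))
                           (trans X-Y≡zN (ℤP.*-comm z _))

module BothSums where

  open import Data.Nat using (ℕ; suc; _+_; _*_; _^_; _<_; s≤s; z≤n)
  import Data.Nat.Properties as ℕP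
  open import Data.Nat.Divisibility using (_∣_; ∣n⇒∣m*n)
  open import Data.Nat.Primality using (Prime)
  open import Data.Nat.Combinatorics using (_C_; nCn≡1)
  import Data.Nat.Tactic.RingSolver as ℕRing
  open import Data.Nat.Solver using (module +-*-Solver)
  open import Data.Integer as ℤ using (ℤ; +_; 1ℤ; -1ℤ)
  import Data.Integer.Properties as ℤP
  open import Data.Rational as ℚ using (ℚ; _/_; 1ℚ)
  open import Relation.Nullary using (¬_)
  open import Relation.Binary.PropositionalEquality
  open import Defs
  open Binomials
  open Congruences
  open PrimePowers
  open Telescoping
  open Lifting

  module Sums {p : ℕ} (prime : Prime p) (p∤2 : ¬ p ∣ 2) (r M : ℕ)
              (p∣p^r : p ∣ p ^ r) (p^r≡ : p ^ r ≡ 2 * M + 3) where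

    open PrimeDivisibility prime
    open Reduction prime r

    q : ℕ
    q = 2 * M + 3

    q>0 : 0 < q
    q>0 = subst (0 <_) (ℕP.+-comm 3 (2 * M)) (s≤s z≤n)

    p∣q : p ∣ q
    p∣q = subst (p ∣_) p^r≡ p∣p^r

    open InnerBinomialsVanish {p} {q} (divides-binomial r (sym p^r≡))

    [-1^M]^4≡1 : (-1ℤ ℤ.^ M) ℤ.^ 4 ≡ 1ℤ
    [-1^M]^4≡1 = begin
      (-1ℤ ℤ.^ M) ℤ.^ 4    ≡⟨ ℤP.^-*-assoc -1ℤ M 4 ⟩
      -1ℤ ℤ.^ (M * 4)      ≡⟨ cong (-1ℤ ℤ.^_) (ℕP.*-comm M 4) ⟩
      -1ℤ ℤ.^ (4 * M)      ≡⟨ ℤP.^-*-assoc -1ℤ 4 M ⟨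
      1ℤ ℤ.^ M             ≡⟨ ℤP.^-zeroˡ M ⟩
      1ℤ                   ∎
      where open ≡-Reasoning

    RHS : ℚ
    RHS = 1ℚ ℚ.- (+ (5 * p ^ (4 * r)) / 1)

    -- Summing up to (q-1)/2 = M+1, i.e. the tail F(m) with m = M+2 = (q+1)/2.
    -- Here C(2m,m)·W = q·V  with  W = m(m-1),  V = (q+1) C(q-1, M).
    module HalfSum where
      m W V : ℕ
      m = suc (suc M)
      W = m * suc M
      V = (4 + 2 * M) * ((2 + 2 * M) C M)

      -- Two absorptions:  m C(2m,m) = 2m C(2m-1,m-1)  and  (m-1) C(2m-1,m-1) = q C(q-1,M)
      central : (2 * m C m) * W ≡ p ^ r * V
      central = begin
        (2 * m C m) * (m * suc M)                             ≡⟨ cong (λ n → (n C m) * W) (two-m M) ⟩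
        ((4 + 2 * M) C m) * (m * suc M)                       ≡⟨ swap ((4 + 2 * M) C m) m (suc M) ⟩
        (m * ((4 + 2 * M) C m)) * suc M                       ≡⟨ cong (_* suc M) (absorption (3 + 2 * M) (suc M)) ⟩
        ((4 + 2 * M) * ((3 + 2 * M) C suc M)) * suc M         ≡⟨ regroup (4 + 2 * M) ((3 + 2 * M) C suc M) (suc M) ⟩
        (4 + 2 * M) * (suc M * ((3 + 2 * M) C suc M))         ≡⟨ cong ((4 + 2 * M) *_) (absorption (2 + 2 * M) M) ⟩
        (4 + 2 * M) * ((3 + 2 * M) * ((2 + 2 * M) C M))      ≡⟨ finish M ((2 + 2 * M) C M) ⟩
        q * V                                                 ≡⟨ cong (_* V) p^r≡ ⟨
        p ^ r * V                                             ∎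
        where
        open ≡-Reasoning
        two-m : ∀ M → 2 * (2 + M) ≡ 4 + 2 * M
        two-m = ℕRing.solve-∀
        swap : ∀ c a b → c * (a * b) ≡ (a * c) * b
        swap = ℕRing.solve-∀
        regroup : ∀ a c b → (a * c) * b ≡ a * (b * c)
        regroup = ℕRing.solve-∀
        finish : ∀ M c → (4 + 2 * M) * ((3 + 2 * M) * c) ≡ (2 * M + 3) * ((4 + 2 * M) * c)
        finish = ℕRing.solve-∀

      -- 4W = (q-1)(q+1) ≡ -1
      4W≡-1 : + (4 * W) ≡ -1ℤ mod p
      4W≡-1 = complete-multiple p∣q q 1 (square M)
        where
        square : ∀ M → 4 * ((2 + M) * (1 + M)) + 1 ≡ (2 * M + 3) * (2 * M + 3)
        square = ℕRing.solve-∀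

      p∤W : ¬ p ∣ W
      p∤W p∣W = ≡-1⇒∤ p∤1 4W≡-1 (∣n⇒∣m*n 4 p∣W)

      256^m : 256 ^ m ≡ (2 ^ q) ^ 4 * 16
      256^m = begin
        256 ^ m            ≡⟨ ℕP.^-*-assoc 2 8 m ⟩
        2 ^ (8 * m)        ≡⟨ cong (2 ^_) (exponent M) ⟩
        2 ^ (q * 4 + 4)    ≡⟨ ℕP.^-distribˡ-+-* 2 (q * 4) 4 ⟩
        2 ^ (q * 4) * 16   ≡⟨ cong (_* 16) (ℕP.^-*-assoc 2 q 4) ⟨
        (2 ^ q) ^ 4 * 16   ∎
        where
        open ≡-Reasoning
        exponent : ∀ M → 8 * (2 + M) ≡ (2 * M + 3) * 4 + 4
        exponent = ℕRing.solve-∀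

      -- 5·256^m·W⁴ ≡ 5·2⁴·16·W⁴ = 5·(4W)⁴ ≡ 5
      5AW⁴≡5 : + (5 * 256 ^ m * W ^ 4) ≡ + 5 mod p
      5AW⁴≡5 = begin
        + (5 * 256 ^ m * W ^ 4)               ≡⟨ cong (λ a → + (5 * a * W ^ 4)) 256^m ⟩
        + (5 * ((2 ^ q) ^ 4 * 16) * W ^ 4)    ≈⟨ *-cong⁺ (*-cong⁺ (mod-refl {a = + 5}) (*-cong⁺ (^-cong⁺ 4 (two^q≡2 q>0)) (mod-refl {a = + 16}))) (mod-refl {a = + (W ^ 4)}) ⟩
        + 1280 ℤ.* + (W ^ 4)                  ≡⟨ ℤP.pos-* 1280 (W ^ 4) ⟨
        + (1280 * W ^ 4)                      ≡⟨ cong +_ (fourth W) ⟩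
        + (5 * (4 * W) ^ 4)                   ≈⟨ *-cong⁺ (mod-refl {a = + 5}) (^-cong⁺ 4 4W≡-1) ⟩
        + 5                                   ∎
        where
        open ≡-mod-Reasoning p
        fourth : ∀ w → 1280 * w ^ 4 ≡ 5 * (4 * w) ^ 4
        fourth = solve 1 (λ w → con 1280 :* w :^ 4 := con 5 :* (con 4 :* w) :^ 4) refl
          where open +-*-Solver

      -- 8m²+4m+1 ≡ 5  and  V ≡ C(q-1,M) ≡ (-1)^M
      PV⁴≡5 : + (weight m * V ^ 4) ≡ + 5 mod p
      PV⁴≡5 = begin
        + (weight m * V ^ 4)         ≈⟨ *-cong⁺ P≡5 (^-cong⁺ 4 (mod-trans V≡C V-alt)) ⟩
        + 5 ℤ.* (-1ℤ ℤ.^ M) ℤ.^ 4    ≡⟨ cong (+ 5 ℤ.*_) [-1^M]^4≡1 ⟩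
        + 5                          ∎
        where
        open ≡-mod-Reasoning p
        P≡5 : + weight m ≡ + 5 mod p
        P≡5 = remove-multiple p∣q (4 * M + 12) 5 (expand M)
          where
          expand : ∀ M → 8 * (2 + M) * (2 + M) + 4 * (2 + M) + 1 ≡ (2 * M + 3) * (4 * M + 12) + 5
          expand = ℕRing.solve-∀
        V≡C : + V ≡ + ((2 + 2 * M) C M) mod p
        V≡C = remove-multiple p∣q ((2 + 2 * M) C M) ((2 + 2 * M) C M) (split M ((2 + 2 * M) C M))
          where
          split : ∀ M c → (4 + 2 * M) * c ≡ (2 * M + 3) * c + c
          split = ℕRing.solve-∀
        V-alt : + ((2 + 2 * M) C M) ≡ -1ℤ ℤ.^ M mod p
        V-alt = alternating (shape M) M (subst (M <_) (shape′ M) (ℕP.m<m+n M {3 + M} (s≤s z≤n)))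
          where
          shape : ∀ M → 2 * M + 3 ≡ 3 + 2 * M
          shape = ℕRing.solve-∀
          shape′ : ∀ M → M + (3 + M) ≡ 2 * M + 3
          shape′ = ℕRing.solve-∀

      result : Cong p (4 * r + 1) (sumTo (suc M)) RHS
      result = sum-congruence p∤2 (suc M)
        (lift {256 ^ m} {weight m} {2 * m C m} {W} {V} central p∤W (mod-trans 5AW⁴≡5 (mod-sym PV⁴≡5)))

    -- Summing up to q-2 = 2M+1, i.e. the tail F(m) with m = q-1.
    -- Here C(2m,m)·W = q·V  with  W = 2m+1 ≡ -1  and  V = C(2m+1,m) = C(q+m,m) ≡ C(m,m) = 1.
    module NearFullSum where
      n m W V : ℕ
      n = 2 * M + 1
      m = suc n
      W = suc (2 * m)
      V = suc (2 * m) C m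

      q≡m+1 : q ≡ suc m
      q≡m+1 = shape M
        where
        shape : ∀ M → 2 * M + 3 ≡ 2 + (2 * M + 1)
        shape = ℕRing.solve-∀

      -- middle absorption:  (2m+1) C(2m,m) = (m+1) C(2m+1,m)
      central : (2 * m C m) * W ≡ p ^ r * V
      central = begin
        (2 * m C m) * W   ≡⟨ ℕP.*-comm (2 * m C m) W ⟩
        W * (2 * m C m)   ≡⟨ middle-absorption m ⟨
        suc m * V         ≡⟨ cong (_* V) q≡m+1 ⟨
        q * V             ≡⟨ cong (_* V) p^r≡ ⟨
        p ^ r * V         ∎
        where open ≡-Reasoning

      -- W + 1 = 2q
      W≡-1 : + W ≡ -1ℤ mod p
      W≡-1 = complete-multiple p∣q 2 1 (double M)
        where
        double : ∀ M → suc (2 * (1 + (2 * M + 1))) + 1 ≡ (2 * M + 3) * 2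
        double = ℕRing.solve-∀

      -- 2·2^m = 2^q ≡ 2, and 2 is invertible mod p
      2^m≡1 : + (2 ^ m) ≡ 1ℤ mod p
      2^m≡1 = cancel-mod-prime {2 ^ m} {1} p∤2
        (subst (λ e → + e ≡ + 2 mod p) (trans (cong (2 ^_) q≡m+1) (ℕP.*-comm 2 (2 ^ m))) (two^q≡2 q>0))

      -- 256^m = (2^m)⁸ ≡ 1  and  W ≡ -1
      5AW⁴≡5 : + (5 * 256 ^ m * W ^ 4) ≡ + 5 mod p
      5AW⁴≡5 = begin
        + (5 * 256 ^ m * W ^ 4)          ≡⟨ cong (λ a → + (5 * a * W ^ 4)) 256^m ⟩
        + (5 * (2 ^ m) ^ 8 * W ^ 4)      ≈⟨ *-cong⁺ (*-cong⁺ (mod-refl {a = + 5}) (^-cong⁺ 8 2^m≡1)) (^-cong⁺ 4 W≡-1) ⟩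
        + 5                              ∎
        where
        open ≡-mod-Reasoning p
        256^m : 256 ^ m ≡ (2 ^ m) ^ 8
        256^m = trans (ℕP.^-*-assoc 2 8 m) (trans (cong (2 ^_) (ℕP.*-comm 8 m)) (sym (ℕP.^-*-assoc 2 m 8)))

      -- 8m²+4m+1 ≡ 5  and  V ≡ 1
      PV⁴≡5 : + (weight m * V ^ 4) ≡ + 5 mod p
      PV⁴≡5 = begin
        + (weight m * V ^ 4)    ≈⟨ *-cong⁺ P≡5 (^-cong⁺ 4 V≡1) ⟩
        + 5                     ∎
        where
        open ≡-mod-Reasoning p
        P≡5 : + weight m ≡ + 5 mod p
        P≡5 = remove-multiple p∣q (16 * M + 12) 5 (expand M)
          where
          expand : ∀ M → let m = 1 + (2 * M + 1) in 8 * m * m + 4 * m + 1 ≡ (2 * M + 3) * (16 * M + 12) + 5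
          expand = ℕRing.solve-∀
        V≡1 : + V ≡ 1ℤ mod p
        V≡1 = subst₂ (λ top c → + (top C m) ≡ + c mod p) (sym (top M)) (nCn≡1 m)
                (shift m m (subst (m <_) (sym q≡m+1) (ℕP.n<1+n m)))
          where
          top : ∀ M → suc (2 * (1 + (2 * M + 1))) ≡ (2 * M + 3) + (1 + (2 * M + 1))
          top = ℕRing.solve-∀

      result : Cong p (4 * r + 1) (sumTo n) RHS
      result = sum-congruence p∤2 n
        (lift {256 ^ m} {weight m} {2 * m C m} {W} {V} central (≡-1⇒∤ p∤1 W≡-1) (mod-trans 5AW⁴≡5 (mod-sym PV⁴≡5)))

open import Defs
open import Data.Nat using (ℕ; _∸_; _/_; _^_; _*_; _+_; _≥_)
open import Data.Nat.Primality using (Prime)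
open import Data.Integer using (+_)
open import Data.Rational using (_-_; 1ℚ)
import Data.Rational
open import Data.Product using (_×_)
open import Relation.Binary.PropositionalEquality using (_≢_)

open import Data.Nat using (suc; _<_; _≤_; s≤s; z≤n)
import Data.Nat.Properties as ℕP
open import Data.Nat.DivMod using (m*n/n≡m)
open import Data.Nat.Divisibility using (_∣_; divides; ∣m∣n⇒∣m+n; m∣m*n; ∣⇒≤)
open import Data.Nat.Primality using (prime[2]; prime⇒irreducible; prime⇒nonZero)
import Data.Nat.Tactic.RingSolver as ℕRing
open import Data.Product using (∃; _,_; proj₁; proj₂)
open import Data.Sum using (inj₁; inj₂)
open import Function using (_∘_)
open import Relation.Nullary using (¬_; contradiction)
open import Relation.Binary.PropositionalEquality using (_≡_; refl; sym; trans; cong; subst; module ≡-Reasoning)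
open PrimePowers
open BothSums
open PrimeDivisibility using (p∤1; p>1; ∤-^)

odd-form : ∀ q → ¬ 2 ∣ q → 1 < q → ∃ λ M → q ≡ 2 * M + 3
odd-form 0 2∤q _ = contradiction (divides 0 refl) 2∤q
odd-form 1 _ (s≤s ())
odd-form 2 2∤q _ = contradiction (divides 1 refl) 2∤q
odd-form 3 _ _ = 0 , refl
odd-form (suc (suc q@(suc (suc _)))) 2∤q+2 _
  with odd-form q (2∤q+2 ∘ ∣m∣n⇒∣m+n (divides 1 refl)) (s≤s (s≤s z≤n))
... | M , q≡2M+3 = suc M , trans (cong (λ x → 2 + x) q≡2M+3) (shift M)
  where
  shift : ∀ M → 2 + (2 * M + 3) ≡ 2 * (1 + M) + 3
  shift = ℕRing.solve-∀

module _ {p : ℕ} (p-prime : Prime p) (p≢2 : p ≢ 2) where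

  p∤2 : ¬ p ∣ 2
  p∤2 p∣2 with prime⇒irreducible prime[2] p∣2
  ... | inj₁ p≡1 = p∤1 p-prime (subst (_∣ 1) (sym p≡1) (divides 1 refl))
  ... | inj₂ p≡2 = p≢2 p≡2

  2∤p : ¬ 2 ∣ p
  2∤p 2∣p with prime⇒irreducible p-prime 2∣p
  ... | inj₁ ()
  ... | inj₂ 2≡p = p≢2 (sym 2≡p)

  p∣p^r : ∀ {r} → r ≥ 1 → p ∣ p ^ r
  p∣p^r {suc r} _ = m∣m*n (p ^ r)

  odd-prime-power : ∀ {r} → r ≥ 1 → ∃ λ M → p ^ r ≡ 2 * M + 3
  odd-prime-power {r} r≥1 = odd-form (p ^ r) (∤-^ prime[2] 2∤p r) (ℕP.<-≤-trans (p>1 p-prime) p≤p^r)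
    where
    p≤p^r : p ≤ p ^ r
    p≤p^r = ∣⇒≤ {{ℕP.m^n≢0 p r {{prime⇒nonZero p-prime}}}} (p∣p^r r≥1)

half-limit : ∀ M → (2 * M + 3 ∸ 1) / 2 ≡ suc M
half-limit M = begin
  (2 * M + 3 ∸ 1) / 2        ≡⟨ cong (λ x → (x ∸ 1) / 2) (shape M) ⟩
  (suc M * 2 + 1 ∸ 1) / 2    ≡⟨ cong (_/ 2) (ℕP.m+n∸n≡m (suc M * 2) 1) ⟩
  suc M * 2 / 2              ≡⟨ m*n/n≡m (suc M) 2 ⟩
  suc M                      ∎
  where
  open ≡-Reasoning
  shape : ∀ M → 2 * M + 3 ≡ (1 + M) * 2 + 1
  shape = ℕRing.solve-∀

near-limit : ∀ M → 2 * M + 3 ∸ 2 ≡ 2 * M + 1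
near-limit M = trans (cong (_∸ 2) (shape M)) (ℕP.m+n∸n≡m (2 * M + 1) 2)
  where
  shape : ∀ M → 2 * M + 3 ≡ 2 * M + 1 + 2
  shape = ℕRing.solve-∀

corollary4p2 : (p r : ℕ) → Prime p → p ≢ 2 → r ≥ 1 →
    Cong p (4 * r + 1) (sumTo ((p ^ r ∸ 1) / 2)) (1ℚ - Data.Rational._/_ (+ (5 * p ^ (4 * r))) 1)
    × Cong p (4 * r + 1) (sumTo (p ^ r ∸ 2)) (1ℚ - Data.Rational._/_ (+ (5 * p ^ (4 * r))) 1)
corollary4p2 p r p-prime p≢2 r≥1 =
  subst (λ n → Cong p (4 * r + 1) (sumTo n) RHS) (sym half) HalfSum.result ,
  subst (λ n → Cong p (4 * r + 1) (sumTo n) RHS) (sym near) NearFullSum.result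
  where
  M : ℕ
  M = proj₁ (odd-prime-power p-prime p≢2 r≥1)
  p^r≡ : p ^ r ≡ 2 * M + 3
  p^r≡ = proj₂ (odd-prime-power p-prime p≢2 r≥1)
  open Sums p-prime (p∤2 p-prime p≢2) r M (p∣p^r p-prime p≢2 r≥1) p^r≡
  half : (p ^ r ∸ 1) / 2 ≡ suc M
  half = trans (cong (λ q → (q ∸ 1) / 2) p^r≡) (half-limit M)
  near : p ^ r ∸ 2 ≡ 2 * M + 1
  near = trans (cong (_∸ 2) p^r≡) (near-limit M)
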